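{- Let $A$ be a finite alphabet and $\mathcal D\subseteq\mathcal P((A\times2)^*)$ a Boolean subalgebra such that $\mathcal D_z=\{\emptyset,A_z\}$. The following are equivalent: (a) $\mathcal D$ is closed under quotients (by words of $(A\times2)^*$), and $A^*\otimes\mathbb N\in\mathcal D$ or $A_z\in\mathcal D$; (b) the map $L\mapsto(L\cap A^*,L\cap(A^*\otimes\mathbb N),L\cap A_z)$ is an isomorphism $\mathcal D\cong\mathcal D_0\times\mathcal D_1\times\{\emptyset,A_z\}$, $\mathcal D_0$ and $\mathcal D_1$ are closed under quotients by words $u\in A^*$ (i.e. $u^{ -1}L,Lu^{ -1}$), and for all $L\in\mathcal D_1$ and all $(w,i)\in A^*\otimes\mathbb N$ we have $(w,i)^{ -1}L,\ L(w,i)^{ -1}\in\mathcal D_0$.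
   Context: $A^*\otimes\mathbb N=\{(w,i):w\in A^*,1\le i\le|w|\}$ is identified with the set of words over $A\times2$ having exactly one letter in $A\times\{1\}$, namely $(a_1,0)\cdots(a_i,1)\cdots(a_n,0)$ for $w=a_1\cdots a_n$; $A^*$ is identified with $(A\times\{0\})^*$; $A_z=(A\times2)^*\setminus(A^*\cup A^*\otimes\mathbb N)$. Quotients: $u^{ -1}L=\{v:uv\in L\}$, $Lu^{ -1}=\{v:vu\in L\}$, computed in $(A\times2)^*$. $\mathcal D_0=\{L\cap A^*:L\in\mathcal D\}$, $\mathcal D_1=\{L\cap(A^*\otimes\mathbb N):L\in\mathcal D\}$, $\mathcal D_z=\{L\cap A_z:L\in\mathcal D\}$. -}

module Defs where

open import Data.Bool using (Bool; true; false; _∧_; _∨_; not)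
open import Data.List using (List; []; _∷_; _++_)
open import Data.Nat using (ℕ; zero; suc; _≡ᵇ_)
open import Data.Product using (_×_; _,_; ∃; proj₂)
open import Data.Sum using (_⊎_)
open import Function using (_∘_)
open import Relation.Binary.PropositionalEquality using (_≡_; _≗_)

-- Words over A × 2 (2 = Bool, false = 0, true = 1) and languages (subsets
-- of (A × 2)^*, given by their characteristic functions).
Word : Set → Set
Word A = List (A × Bool)

Lang : Set → Set
Lang A = Word A → Bool

LangSet : Set → Set₁
LangSet A = Lang A → Set

module _ {A : Set} where

  ∅ₗ : Lang A
  ∅ₗ _ = false

  fullₗ : Lang A
  fullₗ _ = true

  _∩ₗ_ : Lang A → Lang A → Lang A
  (L ∩ₗ M) w = L w ∧ M w

  _∪ₗ_ : Lang A → Lang A → Lang A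
  (L ∪ₗ M) w = L w ∨ M w

  ∁ₗ : Lang A → Lang A
  ∁ₗ L w = not (L w)

  marks : Word A → ℕ
  marks [] = zero
  marks ((a , false) ∷ w) = marks w
  marks ((a , true) ∷ w) = suc (marks w)

  -- A^* identified with (A × {0})^*
  Astar : Lang A
  Astar [] = true
  Astar ((a , b) ∷ w) = not b ∧ Astar w

  -- A^* ⊗ ℕ : words with exactly one letter in A × {1}
  AN : Lang A
  AN w = marks w ≡ᵇ 1

  Az : Lang A
  Az w = not (Astar w ∨ AN w)

  _⁻¹·_ : Word A → Lang A → Lang A
  (u ⁻¹· L) v = L (u ++ v)

  _·⁻¹_ : Lang A → Word A → Lang A
  (L ·⁻¹ u) v = L (v ++ u)

  -- Boolean subalgebra of 𝒫((A×2)^*) (as a set of subsets, so closed under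
  -- extensional equality of languages)
  record IsBooleanSubalgebra (D : LangSet A) : Set where
    field
      resp  : ∀ L M → L ≗ M → D L → D M
      ∅-mem : D ∅ₗ
      full-mem : D fullₗ
      ∩-closed : ∀ L M → D L → D M → D (L ∩ₗ M)
      ∪-closed : ∀ L M → D L → D M → D (L ∪ₗ M)
      ∁-closed : ∀ L → D L → D (∁ₗ L)

  Restrict : LangSet A → Lang A → LangSet A
  Restrict D X M = ∃ λ L → D L × (M ≗ (L ∩ₗ X))

  𝒟₀ 𝒟₁ 𝒟z : LangSet A → LangSet A
  𝒟₀ D = Restrict D Astar
  𝒟₁ D = Restrict D AN
  𝒟z D = Restrict D Az

  ∅-or-Az : LangSet A
  ∅-or-Az M = (M ≗ ∅ₗ) ⊎ (M ≗ Az)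

  SameLangSet : LangSet A → LangSet A → Set
  SameLangSet S T = ∀ M → (S M → T M) × (T M → S M)

  QuotientClosed : LangSet A → Set
  QuotientClosed D = ∀ L u → D L → D (u ⁻¹· L) × D (L ·⁻¹ u)

  QuotientClosedBy : Lang A → LangSet A → Set
  QuotientClosedBy P S = ∀ M u → P u ≡ true → S M → S (u ⁻¹· M) × S (M ·⁻¹ u)

  -- The map Φ : L ↦ (L ∩ A^*, L ∩ A^*⊗ℕ, L ∩ A_z) is an isomorphism of Boolean
  -- algebras 𝒟 ≅ 𝒟₀ × 𝒟₁ × {∅, A_z}  (Boolean operations on the factors are
  -- relative to A^*, A^*⊗ℕ, A_z respectively; equalities are extensional).
  record DecompositionIso (D : LangSet A) : Set where
    field
      well-defined : ∀ L → D L →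
        𝒟₀ D (L ∩ₗ Astar) × 𝒟₁ D (L ∩ₗ AN) × ∅-or-Az (L ∩ₗ Az)
      injective : ∀ L L' → D L → D L' →
        (L ∩ₗ Astar) ≗ (L' ∩ₗ Astar) → (L ∩ₗ AN) ≗ (L' ∩ₗ AN) →
        (L ∩ₗ Az) ≗ (L' ∩ₗ Az) → L ≗ L'
      surjective : ∀ M₀ M₁ M₂ → 𝒟₀ D M₀ → 𝒟₁ D M₁ → ∅-or-Az M₂ →
        ∃ λ L → D L × (M₀ ≗ (L ∩ₗ Astar)) × (M₁ ≗ (L ∩ₗ AN)) × (M₂ ≗ (L ∩ₗ Az))
      pres-∩ : ∀ X → (X ≡ Astar ⊎ X ≡ AN ⊎ X ≡ Az) → ∀ L M → D L → D M →
        ((L ∩ₗ M) ∩ₗ X) ≗ ((L ∩ₗ X) ∩ₗ (M ∩ₗ X))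
      pres-∪ : ∀ X → (X ≡ Astar ⊎ X ≡ AN ⊎ X ≡ Az) → ∀ L M → D L → D M →
        ((L ∪ₗ M) ∩ₗ X) ≗ ((L ∩ₗ X) ∪ₗ (M ∩ₗ X))
      pres-∁ : ∀ X → (X ≡ Astar ⊎ X ≡ AN ⊎ X ≡ Az) → ∀ L → D L →
        (∁ₗ L ∩ₗ X) ≗ (X ∩ₗ ∁ₗ (L ∩ₗ X))

-- The regions A^*, A^* ⊗ ℕ, A_z partition (A × 2)^*, and on each of them a quotient by u
-- depends only on the number of marks of u: with none the regions are preserved; with one,
-- A^* ⊗ ℕ is pulled back to A^* and everything else into A_z; with two or more, everything
-- is pulled into A_z, where 𝒟 sees only ∅ and A_z. Under (b) a language lies in 𝒟 as soon
-- as its three restrictions lie in the factors, so quotient closure follows; surjectivity at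
-- (∅, ∅, A_z) gives A_z ∈ 𝒟. Under (a), quotienting A^* ⊗ ℕ (or the complement of A_z) by
-- one marked letter gives A^*, so all three regions lie in 𝒟 and any triple of parts is glued
-- back together as a union of restrictions.

module Submission where

open import Defs
open import Data.Bool using (Bool; true; false; _∧_; _∨_; not)
open import Data.Bool.Properties
  using ( ∧-assoc; ∧-comm; ∧-idem; ∧-identityʳ; ∧-zeroʳ; ∧-inverseˡ; ∧-inverseʳ
        ; ∧-distribʳ-∨; ∨-identityʳ; not-involutive; ∧-idempotentCommutativeMonoid )
open import Algebra.Properties.IdempotentCommutativeMonoid ∧-idempotentCommutativeMonoid
  using (∙-distrʳ-∙)
open import Data.Empty using (⊥-elim)
open import Data.Fin as Fin using (Fin)
open import Data.Fin.Properties using (¬Fin0)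
open import Data.List using ([]; _∷_; _++_)
open import Data.Nat using (ℕ; zero; suc; _+_; _≤_; _≡ᵇ_; z≤n; s≤s)
open import Data.Nat.Properties using (+-comm; ≤-trans; ≤-reflexive; m≤n+m)
open import Data.Product using (_×_; _,_; ∃; proj₁; proj₂)
open import Data.Sum using (_⊎_; inj₁; inj₂)
open import Function using (_∘_)
open import Function.Bundles using (_↔_; Inverse)
open import Relation.Nullary using (¬_)
open import Relation.Binary.PropositionalEquality
  using (_≡_; refl; sym; trans; cong; subst; _≗_; module ≡-Reasoning)

∧-cancelʳ-true : ∀ {l l' x} → x ≡ true → l ∧ x ≡ l' ∧ x → l ≡ l'
∧-cancelʳ-true {l} {l'} refl e = trans (sym (∧-identityʳ l)) (trans e (∧-identityʳ l'))

∧-injective-on-partition : ∀ l l' a n → l ∧ a ≡ l' ∧ a → l ∧ n ≡ l' ∧ n →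
  l ∧ not (a ∨ n) ≡ l' ∧ not (a ∨ n) → l ≡ l'
∧-injective-on-partition l l' true  n     e _ _ = ∧-cancelʳ-true refl e
∧-injective-on-partition l l' false true  _ e _ = ∧-cancelʳ-true refl e
∧-injective-on-partition l l' false false _ _ e = ∧-cancelʳ-true refl e

not-∨-∧ˡ : ∀ a n → not (a ∨ n) ∧ a ≡ false
not-∨-∧ˡ true  n = refl
not-∨-∧ˡ false n = ∧-zeroʳ (not n)

not-∨-∧ʳ : ∀ a n → not (a ∨ n) ∧ n ≡ false
not-∨-∧ʳ true  n = refl
not-∨-∧ʳ false n = ∧-inverseˡ n

not-∧-distrib : ∀ l x → not l ∧ x ≡ x ∧ not (l ∧ x)
not-∧-distrib true  x = sym (∧-inverseʳ x)
not-∧-distrib false x = sym (∧-identityʳ x)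

disjoint⇒complement : ∀ a n → a ∧ n ≡ false → n ≡ not (a ∨ not (a ∨ n))
disjoint⇒complement true  n e = e
disjoint⇒complement false n _ = sym (not-involutive n)

restrict-const : ∀ l b x → (x ≡ true → l ≡ b) → l ∧ x ≡ b ∧ x
restrict-const l b true  h = cong (_∧ true) (h refl)
restrict-const l b false _ = trans (∧-zeroʳ l) (sym (∧-zeroʳ b))

isMany : ℕ → Bool
isMany k = not ((k ≡ᵇ 0) ∨ (k ≡ᵇ 1))

2≤⇒isMany : ∀ {k} → 2 ≤ k → isMany k ≡ true
2≤⇒isMany (s≤s (s≤s _)) = refl

isMany⇒2≤ : ∀ k → isMany k ≡ true → 2 ≤ k
isMany⇒2≤ (suc (suc k)) _ = s≤s (s≤s z≤n)

≡ᵇ1⇒≡1 : ∀ k → (k ≡ᵇ 1) ≡ true → k ≡ 1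
≡ᵇ1⇒≡1 (suc zero) _ = refl

letter-or-empty : ∀ {A : Set} n → A ↔ Fin n → A ⊎ ¬ A
letter-or-empty zero    A↔Fin = inj₂ (¬Fin0 ∘ Inverse.to A↔Fin)
letter-or-empty (suc n) A↔Fin = inj₁ (Inverse.from A↔Fin Fin.zero)

module _ {A : Set} where

  marks-++ : (u v : Word A) → marks (u ++ v) ≡ marks u + marks v
  marks-++ [] v = refl
  marks-++ ((a , false) ∷ u) v = marks-++ u v
  marks-++ ((a , true)  ∷ u) v = cong suc (marks-++ u v)

  Astar-marks : (w : Word A) → Astar w ≡ (marks w ≡ᵇ 0)
  Astar-marks [] = refl
  Astar-marks ((a , false) ∷ w) = Astar-marks w
  Astar-marks ((a , true)  ∷ w) = refl

  Astar⇒marks≡0 : (w : Word A) → Astar w ≡ true → marks w ≡ 0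
  Astar⇒marks≡0 [] _ = refl
  Astar⇒marks≡0 ((a , false) ∷ w) p = Astar⇒marks≡0 w p

  AN⇒marks≡1 : (w : Word A) → AN w ≡ true → marks w ≡ 1
  AN⇒marks≡1 w = ≡ᵇ1⇒≡1 (marks w)

  Az-marks : (w : Word A) → Az w ≡ isMany (marks w)
  Az-marks w = cong (λ b → not (b ∨ AN w)) (Astar-marks w)

  Astar∩AN≗∅ : (Astar ∩ₗ AN) ≗ ∅ₗ {A}
  Astar∩AN≗∅ w = trans (cong (_∧ AN w) (Astar-marks w)) (zero-one-disjoint (marks w))
    where
    zero-one-disjoint : ∀ k → (k ≡ᵇ 0) ∧ (k ≡ᵇ 1) ≡ false
    zero-one-disjoint zero    = refl
    zero-one-disjoint (suc k) = refl

  Az∩Astar≗∅ : (Az ∩ₗ Astar) ≗ ∅ₗ {A}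
  Az∩Astar≗∅ w = not-∨-∧ˡ (Astar w) (AN w)

  Az∩AN≗∅ : (Az ∩ₗ AN) ≗ ∅ₗ {A}
  Az∩AN≗∅ w = not-∨-∧ʳ (Astar w) (AN w)

  ∩-comm-∅ : (X Y : Lang A) → (X ∩ₗ Y) ≗ ∅ₗ → (Y ∩ₗ X) ≗ ∅ₗ
  ∩-comm-∅ X Y e w = trans (∧-comm (Y w) (X w)) (e w)

  -- u⁻¹L = L ∘ (u ++_) and L u⁻¹ = L ∘ (_++ u), with both maps shifting marks by marks u.
  ShiftsMarksBy : ℕ → (Word A → Word A) → Set
  ShiftsMarksBy m f = ∀ v → marks (f v) ≡ m + marks v

  prefix-shifts : ∀ {m} u → marks u ≡ m → ShiftsMarksBy m (u ++_)
  prefix-shifts u refl = marks-++ u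

  suffix-shifts : ∀ {m} u → marks u ≡ m → ShiftsMarksBy m (_++ u)
  suffix-shifts u refl v = trans (marks-++ v u) (+-comm (marks v) (marks u))

  Astar-pullback₀ : ∀ f → ShiftsMarksBy 0 f → (Astar ∘ f) ≗ Astar
  Astar-pullback₀ f s v =
    trans (Astar-marks (f v)) (trans (cong (_≡ᵇ 0) (s v)) (sym (Astar-marks v)))

  AN-pullback₀ : ∀ f → ShiftsMarksBy 0 f → (AN ∘ f) ≗ AN
  AN-pullback₀ f s v = cong (_≡ᵇ 1) (s v)

  AN-pullback₁ : ∀ f → ShiftsMarksBy 1 f → (AN ∘ f) ≗ Astar
  AN-pullback₁ f s v = trans (cong (_≡ᵇ 1) (s v)) (sym (Astar-marks v))

  Az-pullback : ∀ {m} f → ShiftsMarksBy m f → ∀ w → 2 ≤ m + marks w → Az (f w) ≡ true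
  Az-pullback f s w h =
    trans (Az-marks (f w)) (2≤⇒isMany (subst (2 ≤_) (sym (s w)) h))

  Az⊆Az-pullback : ∀ {m} f → ShiftsMarksBy m f → ∀ w → Az w ≡ true → Az (f w) ≡ true
  Az⊆Az-pullback {m} f s w p =
    Az-pullback f s w
      (≤-trans (isMany⇒2≤ (marks w) (trans (sym (Az-marks w)) p)) (m≤n+m (marks w) m))

  ∩-∩-idem : (L X : Lang A) → ((L ∩ₗ X) ∩ₗ X) ≗ (L ∩ₗ X)
  ∩-∩-idem L X w = trans (∧-assoc (L w) (X w) (X w)) (cong (L w ∧_) (∧-idem (X w)))

  ∩-∩-∅ : (L Y X : Lang A) → (Y ∩ₗ X) ≗ ∅ₗ → ((L ∩ₗ Y) ∩ₗ X) ≗ ∅ₗ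
  ∩-∩-∅ L Y X e w =
    trans (∧-assoc (L w) (Y w) (X w)) (trans (cong (L w ∧_) (e w)) (∧-zeroʳ (L w)))

  ∪-∩-dropʳ : (P R X : Lang A) → (R ∩ₗ X) ≗ ∅ₗ → ((P ∪ₗ R) ∩ₗ X) ≗ (P ∩ₗ X)
  ∪-∩-dropʳ P R X e w =
    trans (∧-distribʳ-∨ (X w) (P w) (R w)) (trans (cong (P w ∧ X w ∨_) (e w)) (∨-identityʳ _))

  ∪-∩-dropˡ : (P R X : Lang A) → (P ∩ₗ X) ≗ ∅ₗ → ((P ∪ₗ R) ∩ₗ X) ≗ (R ∩ₗ X)
  ∪-∩-dropˡ P R X e w = trans (∧-distribʳ-∨ (X w) (P w) (R w)) (cong (_∨ R w ∧ X w) (e w))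

  glue : Lang A → Lang A → Lang A → Lang A
  glue L₀ L₁ L₂ = ((L₀ ∩ₗ Astar) ∪ₗ (L₁ ∩ₗ AN)) ∪ₗ (L₂ ∩ₗ Az)

  glue-Astar : ∀ L₀ L₁ L₂ → (glue L₀ L₁ L₂ ∩ₗ Astar) ≗ (L₀ ∩ₗ Astar)
  glue-Astar L₀ L₁ L₂ w = begin
    (glue L₀ L₁ L₂ ∩ₗ Astar) w
      ≡⟨ ∪-∩-dropʳ ((L₀ ∩ₗ Astar) ∪ₗ (L₁ ∩ₗ AN)) (L₂ ∩ₗ Az) Astar (∩-∩-∅ L₂ Az Astar Az∩Astar≗∅) w ⟩
    (((L₀ ∩ₗ Astar) ∪ₗ (L₁ ∩ₗ AN)) ∩ₗ Astar) w
      ≡⟨ ∪-∩-dropʳ (L₀ ∩ₗ Astar) (L₁ ∩ₗ AN) Astar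
           (∩-∩-∅ L₁ AN Astar (∩-comm-∅ Astar AN Astar∩AN≗∅)) w ⟩
    ((L₀ ∩ₗ Astar) ∩ₗ Astar) w
      ≡⟨ ∩-∩-idem L₀ Astar w ⟩
    (L₀ ∩ₗ Astar) w ∎
    where open ≡-Reasoning

  glue-AN : ∀ L₀ L₁ L₂ → (glue L₀ L₁ L₂ ∩ₗ AN) ≗ (L₁ ∩ₗ AN)
  glue-AN L₀ L₁ L₂ w = begin
    (glue L₀ L₁ L₂ ∩ₗ AN) w
      ≡⟨ ∪-∩-dropʳ ((L₀ ∩ₗ Astar) ∪ₗ (L₁ ∩ₗ AN)) (L₂ ∩ₗ Az) AN (∩-∩-∅ L₂ Az AN Az∩AN≗∅) w ⟩
    (((L₀ ∩ₗ Astar) ∪ₗ (L₁ ∩ₗ AN)) ∩ₗ AN) w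
      ≡⟨ ∪-∩-dropˡ (L₀ ∩ₗ Astar) (L₁ ∩ₗ AN) AN (∩-∩-∅ L₀ Astar AN Astar∩AN≗∅) w ⟩
    ((L₁ ∩ₗ AN) ∩ₗ AN) w
      ≡⟨ ∩-∩-idem L₁ AN w ⟩
    (L₁ ∩ₗ AN) w ∎
    where open ≡-Reasoning

  glue-Az : ∀ L₀ L₁ L₂ → (glue L₀ L₁ L₂ ∩ₗ Az) ≗ (L₂ ∩ₗ Az)
  glue-Az L₀ L₁ L₂ w = begin
    (glue L₀ L₁ L₂ ∩ₗ Az) w
      ≡⟨ ∪-∩-dropˡ ((L₀ ∩ₗ Astar) ∪ₗ (L₁ ∩ₗ AN)) (L₂ ∩ₗ Az) Az glued-part-outside-Az w ⟩
    ((L₂ ∩ₗ Az) ∩ₗ Az) w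
      ≡⟨ ∩-∩-idem L₂ Az w ⟩
    (L₂ ∩ₗ Az) w ∎
    where
    open ≡-Reasoning
    glued-part-outside-Az : (((L₀ ∩ₗ Astar) ∪ₗ (L₁ ∩ₗ AN)) ∩ₗ Az) ≗ ∅ₗ
    glued-part-outside-Az v =
      trans (∪-∩-dropˡ (L₀ ∩ₗ Astar) (L₁ ∩ₗ AN) Az
               (∩-∩-∅ L₀ Astar Az (∩-comm-∅ Az Astar Az∩Astar≗∅)) v)
            (∩-∩-∅ L₁ AN Az (∩-comm-∅ Az AN Az∩AN≗∅) v)

  ≗-from-parts : {L L' : Lang A} → (L ∩ₗ Astar) ≗ (L' ∩ₗ Astar) → (L ∩ₗ AN) ≗ (L' ∩ₗ AN) →
    (L ∩ₗ Az) ≗ (L' ∩ₗ Az) → L ≗ L'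
  ≗-from-parts {L} {L'} e₀ e₁ e₂ w =
    ∧-injective-on-partition (L w) (L' w) (Astar w) (AN w) (e₀ w) (e₁ w) (e₂ w)

  ∩-pullback : (L Y : Lang A) {X : Lang A} (f : Word A → Word A) →
    (Y ∘ f) ≗ X → ((L ∘ f) ∩ₗ X) ≗ ((L ∩ₗ Y) ∘ f)
  ∩-pullback L Y f e w = cong (L (f w) ∧_) (sym (e w))

  pullback-within-Az : (L X : Lang A) (f : Word A → Word A) →
    (∀ w → X w ≡ true → Az (f w) ≡ true) → ∅-or-Az (L ∩ₗ Az) →
    ((L ∘ f) ∩ₗ X) ≗ ∅ₗ ⊎ ((L ∘ f) ∩ₗ X) ≗ X
  pullback-within-Az L X f X⊆Az∘f (inj₁ e) = inj₁ λ w →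
    restrict-const (L (f w)) false (X w) (λ p → ∧-cancelʳ-true (X⊆Az∘f w p) (e (f w)))
  pullback-within-Az L X f X⊆Az∘f (inj₂ e) = inj₂ λ w →
    restrict-const (L (f w)) true (X w) (λ p → ∧-cancelʳ-true (X⊆Az∘f w p) (e (f w)))

  Restrict-resp : (D : LangSet A) {X M N : Lang A} → M ≗ N → Restrict D X N → Restrict D X M
  Restrict-resp D M≗N (L , DL , e) = L , DL , λ w → trans (M≗N w) (e w)

  Restrict-pullback : (D : LangSet A) {X Y M : Lang A} (f : Word A → Word A) →
    (∀ L → D L → D (L ∘ f)) → (X ∘ f) ≗ Y → Restrict D X M → Restrict D Y (M ∘ f)
  Restrict-pullback D f closed X∘f≗Y (L , DL , e) =
    L ∘ f , closed L DL , λ v → trans (e (f v)) (cong (L (f v) ∧_) (X∘f≗Y v))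

module _ {A : Set} (D : LangSet A) (BA : IsBooleanSubalgebra D) where
  open IsBooleanSubalgebra BA

  Az-∈ : D Astar → D AN → D Az
  Az-∈ Astar∈D AN∈D = resp _ Az (λ _ → refl) (∁-closed _ (∪-closed _ _ Astar∈D AN∈D))

  AN-∈ : D Astar → D Az → D AN
  AN-∈ Astar∈D Az∈D = resp _ AN
    (λ w → sym (disjoint⇒complement (Astar w) (AN w) (Astar∩AN≗∅ w)))
    (∁-closed _ (∪-closed _ _ Astar∈D Az∈D))

  Astar-∈ : A → QuotientClosed D → D AN ⊎ D Az → D Astar
  Astar-∈ a qc (inj₁ AN∈D) =
    resp _ Astar (λ v → sym (Astar-marks v)) (proj₁ (qc AN ((a , true) ∷ []) AN∈D))
  Astar-∈ a qc (inj₂ Az∈D) =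
    resp _ Astar (λ v → trans (not-involutive _) (sym (Astar-marks v)))
      (proj₁ (qc (∁ₗ Az) ((a , true) ∷ []) (∁-closed Az Az∈D)))

  regions-∈ : A ⊎ ¬ A → QuotientClosed D → D AN ⊎ D Az → D Astar × D AN × D Az
  regions-∈ (inj₁ a) qc (inj₁ AN∈D) = Astar∈D , AN∈D , Az-∈ Astar∈D AN∈D
    where Astar∈D = Astar-∈ a qc (inj₁ AN∈D)
  regions-∈ (inj₁ a) qc (inj₂ Az∈D) = Astar∈D , AN-∈ Astar∈D Az∈D , Az∈D
    where Astar∈D = Astar-∈ a qc (inj₂ Az∈D)
  regions-∈ (inj₂ ¬A) _ _ =
    resp fullₗ Astar (constant Astar) full-mem ,
    resp ∅ₗ AN (constant AN) ∅-mem ,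
    resp ∅ₗ Az (constant Az) ∅-mem
    where
    only-ε : (w : Word A) → [] ≡ w
    only-ε [] = refl
    only-ε ((a , _) ∷ _) = ⊥-elim (¬A a)
    constant : (X : Lang A) → (λ _ → X []) ≗ X
    constant X w = cong X (only-ε w)

  glue-∈ : D Astar → D AN → D Az → ∀ {L₀ L₁ L₂} → D L₀ → D L₁ → D L₂ → D (glue L₀ L₁ L₂)
  glue-∈ Astar∈D AN∈D Az∈D L₀∈D L₁∈D L₂∈D =
    ∪-closed _ _ (∪-closed _ _ (∩-closed _ _ L₀∈D Astar∈D) (∩-closed _ _ L₁∈D AN∈D))
      (∩-closed _ _ L₂∈D Az∈D)

  decomposition-iso : SameLangSet (𝒟z D) ∅-or-Az → D Astar → D AN → D Az → DecompositionIso D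
  decomposition-iso hz Astar∈D AN∈D Az∈D = record
    { well-defined = λ L L∈D →
        (L , L∈D , λ _ → refl) , (L , L∈D , λ _ → refl) ,
        proj₁ (hz (L ∩ₗ Az)) (L , L∈D , λ _ → refl)
    ; injective = λ _ _ _ _ → ≗-from-parts
    ; surjective = surjective
    ; pres-∩ = λ X _ L M _ _ w → ∙-distrʳ-∙ (X w) (L w) (M w)
    ; pres-∪ = λ X _ L M _ _ w → ∧-distribʳ-∨ (X w) (L w) (M w)
    ; pres-∁ = λ X _ L _ w → not-∧-distrib (L w) (X w)
    }
    where
    surjective : ∀ M₀ M₁ M₂ → 𝒟₀ D M₀ → 𝒟₁ D M₁ → ∅-or-Az M₂ →
      ∃ λ L → D L × (M₀ ≗ (L ∩ₗ Astar)) × (M₁ ≗ (L ∩ₗ AN)) × (M₂ ≗ (L ∩ₗ Az))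
    surjective M₀ M₁ M₂ (L₀ , L₀∈D , e₀) (L₁ , L₁∈D , e₁) M₂∈ =
      let (L₂ , L₂∈D , e₂) = proj₂ (hz M₂) M₂∈ in
      glue L₀ L₁ L₂ ,
      glue-∈ Astar∈D AN∈D Az∈D L₀∈D L₁∈D L₂∈D ,
      (λ w → trans (e₀ w) (sym (glue-Astar L₀ L₁ L₂ w))) ,
      (λ w → trans (e₁ w) (sym (glue-AN L₀ L₁ L₂ w))) ,
      (λ w → trans (e₂ w) (sym (glue-Az L₀ L₁ L₂ w)))

  Restrict-quotients : QuotientClosed D → ∀ {m X Y M} u → marks u ≡ m →
    (∀ f → ShiftsMarksBy m f → (X ∘ f) ≗ Y) →
    Restrict D X M → Restrict D Y (u ⁻¹· M) × Restrict D Y (M ·⁻¹ u)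
  Restrict-quotients qc u eq pullback r =
    Restrict-pullback D (u ++_) (λ L L∈D → proj₁ (qc L u L∈D))
      (pullback (u ++_) (prefix-shifts u eq)) r ,
    Restrict-pullback D (_++ u) (λ L L∈D → proj₂ (qc L u L∈D))
      (pullback (_++ u) (suffix-shifts u eq)) r

  𝒟₀-quotients : QuotientClosed D → QuotientClosedBy Astar (𝒟₀ D)
  𝒟₀-quotients qc M u u∈A* = Restrict-quotients qc u (Astar⇒marks≡0 u u∈A*) Astar-pullback₀

  𝒟₁-quotients : QuotientClosed D → QuotientClosedBy Astar (𝒟₁ D)
  𝒟₁-quotients qc M u u∈A* = Restrict-quotients qc u (Astar⇒marks≡0 u u∈A*) AN-pullback₀

  𝒟₁-quotients-AN : QuotientClosed D →
    ∀ M x → AN x ≡ true → 𝒟₁ D M → 𝒟₀ D (x ⁻¹· M) × 𝒟₀ D (M ·⁻¹ x)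
  𝒟₁-quotients-AN qc M x x∈AN = Restrict-quotients qc x (AN⇒marks≡1 x x∈AN) AN-pullback₁

  Restrict-∅-or-whole : ∀ {X M} → M ≗ ∅ₗ ⊎ M ≗ X → Restrict D X M
  Restrict-∅-or-whole (inj₁ e) = ∅ₗ , ∅-mem , e
  Restrict-∅-or-whole (inj₂ e) = fullₗ , full-mem , e

  module _ (iso : DecompositionIso D) where
    open DecompositionIso iso

    assemble : ∀ K → 𝒟₀ D (K ∩ₗ Astar) → 𝒟₁ D (K ∩ₗ AN) → ∅-or-Az (K ∩ₗ Az) → D K
    assemble K p₀ p₁ p₂ =
      let (L , L∈D , e₀ , e₁ , e₂) = surjective _ _ _ p₀ p₁ p₂ in
      resp L K (λ w → sym (≗-from-parts e₀ e₁ e₂ w)) L∈D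

    Az-∈-of-iso : D Az
    Az-∈-of-iso = assemble Az (∅ₗ , ∅-mem , Az∩Astar≗∅) (∅ₗ , ∅-mem , Az∩AN≗∅)
      (inj₂ λ w → ∧-idem (Az w))

    Az-part : ∀ L → D L → ∅-or-Az (L ∩ₗ Az)
    Az-part L L∈D = proj₂ (proj₂ (well-defined L L∈D))

    pullback-∈₀ : ∀ f → ShiftsMarksBy 0 f → ∀ L → D L →
      𝒟₀ D ((L ∩ₗ Astar) ∘ f) → 𝒟₁ D ((L ∩ₗ AN) ∘ f) → D (L ∘ f)
    pullback-∈₀ f s L L∈D p₀ p₁ = assemble (L ∘ f)
      (Restrict-resp D (∩-pullback L Astar f (Astar-pullback₀ f s)) p₀)
      (Restrict-resp D (∩-pullback L AN f (AN-pullback₀ f s)) p₁)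
      (pullback-within-Az L Az f (Az⊆Az-pullback f s) (Az-part L L∈D))

    pullback-∈₁ : ∀ f → ShiftsMarksBy 1 f → ∀ L → D L → 𝒟₀ D ((L ∩ₗ AN) ∘ f) → D (L ∘ f)
    pullback-∈₁ f s L L∈D p₀ = assemble (L ∘ f)
      (Restrict-resp D (∩-pullback L AN f (AN-pullback₁ f s)) p₀)
      (Restrict-∅-or-whole (pullback-within-Az L AN f AN⊆Az∘f (Az-part L L∈D)))
      (pullback-within-Az L Az f (Az⊆Az-pullback f s) (Az-part L L∈D))
      where
      AN⊆Az∘f : ∀ w → AN w ≡ true → Az (f w) ≡ true
      AN⊆Az∘f w p = Az-pullback f s w (s≤s (≤-reflexive (sym (AN⇒marks≡1 w p))))

    pullback-∈₂ : ∀ {j} f → ShiftsMarksBy (2 + j) f → ∀ L → D L → D (L ∘ f)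
    pullback-∈₂ f s L L∈D = assemble (L ∘ f)
      (Restrict-∅-or-whole (within Astar)) (Restrict-∅-or-whole (within AN)) (within Az)
      where
      within : ∀ X → ((L ∘ f) ∩ₗ X) ≗ ∅ₗ ⊎ ((L ∘ f) ∩ₗ X) ≗ X
      within X =
        pullback-within-Az L X f (λ w _ → Az-pullback f s w (s≤s (s≤s z≤n))) (Az-part L L∈D)

    quotient-closed : QuotientClosedBy Astar (𝒟₀ D) → QuotientClosedBy Astar (𝒟₁ D) →
      (∀ M x → AN x ≡ true → 𝒟₁ D M → 𝒟₀ D (x ⁻¹· M) × 𝒟₀ D (M ·⁻¹ x)) →
      QuotientClosed D
    quotient-closed q₀ q₁ q₂ L u L∈D with marks u in eq
    ... | zero =
      pullback-∈₀ (u ++_) (prefix-shifts u eq) L L∈D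
        (proj₁ (q₀ _ u u∈A* p₀)) (proj₁ (q₁ _ u u∈A* p₁)) ,
      pullback-∈₀ (_++ u) (suffix-shifts u eq) L L∈D
        (proj₂ (q₀ _ u u∈A* p₀)) (proj₂ (q₁ _ u u∈A* p₁))
      where
      p₀ = proj₁ (well-defined L L∈D)
      p₁ = proj₁ (proj₂ (well-defined L L∈D))
      u∈A* = trans (Astar-marks u) (cong (_≡ᵇ 0) eq)
    ... | suc zero =
      pullback-∈₁ (u ++_) (prefix-shifts u eq) L L∈D (proj₁ (q₂ _ u (cong (_≡ᵇ 1) eq) p₁)) ,
      pullback-∈₁ (_++ u) (suffix-shifts u eq) L L∈D (proj₂ (q₂ _ u (cong (_≡ᵇ 1) eq) p₁))
      where p₁ = proj₁ (proj₂ (well-defined L L∈D))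
    ... | suc (suc j) =
      pullback-∈₂ (u ++_) (prefix-shifts u eq) L L∈D ,
      pullback-∈₂ (_++ u) (suffix-shifts u eq) L L∈D

lemma4p4 : {A : Set} (n : ℕ) → A ↔ Fin n →
    (D : LangSet A) → IsBooleanSubalgebra D →
    SameLangSet (𝒟z D) ∅-or-Az →
    ((QuotientClosed D × (D AN ⊎ D Az)) →
      (DecompositionIso D × QuotientClosedBy Astar (𝒟₀ D) × QuotientClosedBy Astar (𝒟₁ D)
        × (∀ L x → AN x ≡ true → 𝒟₁ D L → 𝒟₀ D (x ⁻¹· L) × 𝒟₀ D (L ·⁻¹ x))))
    × ((DecompositionIso D × QuotientClosedBy Astar (𝒟₀ D) × QuotientClosedBy Astar (𝒟₁ D)
        × (∀ L x → AN x ≡ true → 𝒟₁ D L → 𝒟₀ D (x ⁻¹· L) × 𝒟₀ D (L ·⁻¹ x)))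
      → (QuotientClosed D × (D AN ⊎ D Az)))
lemma4p4 n A↔Fin D BA hz =
  (λ (qc , AN-or-Az) →
    let (Astar∈D , AN∈D , Az∈D) = regions-∈ D BA (letter-or-empty n A↔Fin) qc AN-or-Az in
    decomposition-iso D BA hz Astar∈D AN∈D Az∈D ,
    𝒟₀-quotients D BA qc , 𝒟₁-quotients D BA qc , 𝒟₁-quotients-AN D BA qc) ,
  (λ (iso , q₀ , q₁ , q₂) →
    quotient-closed D BA iso q₀ q₁ q₂ , inj₂ (Az-∈-of-iso D BA iso))
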